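{- For every signed graph $G=(V,E^+,E^-)$ whose underlying unsigned graph $(V,E^+\cup E^-)$ is connected, $a_{so}(G)\geq \delta^+(G)+1$.
   Context: A signed graph is a triple $G=(V,E^+,E^-)$ with $V$ finite, $E^+,E^-\subseteq\binom{V}{2}$ and $E^+\cap E^-=\emptyset$. $N^+(v)=\{u: uv\in E^+\}$, $N^-(v)=\{u: uv\in E^-\}$, $N(v)=N^+(v)\cup N^-(v)$. For $X\subseteq V$, $\deg^+_X(v)=|N^+(v)\cap X|$, $\deg^-_X(v)=|N^-(v)\cap X|$, $\overline{X}=V\setminus X$. $\delta^+(G)$ is the minimum over $v\in V$ of $|N^+(v)|$. For $S\subseteq V$, $\partial S=\left(\bigcup_{u\in S}N(u)\right)\setminus S$. A set $S\subseteq V$ is an offensive alliance if for every $w\in\partial S$: (1) $\deg^-_S(w)\geq \deg^+_S(w)$ and (2) $\deg^-_S(w)\geq \deg^+_{\overline S}(w)+1$. $a_{so}(G)$ denotes the size of a smallest non-empty offensive alliance of $G$ (note $V$ itself is always an offensive alliance). -}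

module Defs where

open import Data.Bool using (Bool; true; false)
open import Data.Nat using (ℕ; zero; suc; _+_; _≤_; _⊓_)
open import Data.Fin using (Fin)
import Data.Fin as F
open import Data.Fin.Subset using (Subset; _∈_; _∉_; _∩_; ∁; ∣_∣; Nonempty)
open import Data.Vec using (tabulate)
open import Data.Product using (Σ; ∃; _×_; _,_)
open import Data.Sum using (_⊎_)
open import Data.Empty using (⊥)
open import Relation.Binary.PropositionalEquality using (_≡_)
open import Relation.Binary.Construct.Closure.ReflexiveTransitive using (Star)

-- A signed graph on vertex set V = Fin n.  E⁺ and E⁻ are given by their
-- (Boolean) indicator relations; edges are unordered pairs of distinct
-- vertices (symmetric, irreflexive) and E⁺ ∩ E⁻ = ∅.
record SignedGraph (n : ℕ) : Set where
  field
    pos : Fin n → Fin n → Bool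
    neg : Fin n → Fin n → Bool
    pos-sym : ∀ u v → pos u v ≡ pos v u
    neg-sym : ∀ u v → neg u v ≡ neg v u
    pos-irrefl : ∀ v → pos v v ≡ false
    neg-irrefl : ∀ v → neg v v ≡ false
    disjoint : ∀ u v → pos u v ≡ true → neg u v ≡ false

module _ {n : ℕ} (G : SignedGraph n) where
  open SignedGraph G

  N⁺ : Fin n → Subset n
  N⁺ v = tabulate (pos v)

  N⁻ : Fin n → Subset n
  N⁻ v = tabulate (neg v)

  deg⁺ : Subset n → Fin n → ℕ
  deg⁺ X v = ∣ N⁺ v ∩ X ∣

  deg⁻ : Subset n → Fin n → ℕ
  deg⁻ X v = ∣ N⁻ v ∩ X ∣

  Adj : Fin n → Fin n → Set
  Adj u v = (pos u v ≡ true) ⊎ (neg u v ≡ true)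

  Connected : Set
  Connected = ∀ u v → Star Adj u v

  InBoundary : Subset n → Fin n → Set
  InBoundary S w = w ∉ S × ∃ (λ u → u ∈ S × Adj u w)

  IsOffensiveAlliance : Subset n → Set
  IsOffensiveAlliance S =
    ∀ w → InBoundary S w →
      (deg⁺ S w ≤ deg⁻ S w) × (deg⁺ (∁ S) w + 1 ≤ deg⁻ S w)

minFin : ∀ {n} → (Fin (suc n) → ℕ) → ℕ
minFin {zero} f = f F.zero
minFin {suc n} f = f F.zero ⊓ minFin (λ i → f (F.suc i))

δ⁺ : ∀ {n} → SignedGraph (suc n) → ℕ
δ⁺ G = minFin (λ v → ∣ N⁺ G v ∣)

-- Take v ∈ S.  If S = V, then ∣S∣ = ∣V∣ > ∣N⁺(v)∣ because v ∉ N⁺(v).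
-- Otherwise connectivity yields a boundary vertex w, and splitting N⁺(w)
-- along S gives
--   ∣N⁺(w)∣ + 1 = deg⁺_S(w) + deg⁺_S̄(w) + 1 ≤ deg⁺_S(w) + deg⁻_S(w) ≤ ∣S∣,
-- the last step because N⁺(w) and N⁻(w) are disjoint.  In both cases some
-- vertex has ∣N⁺(v)∣ < ∣S∣, and δ⁺(G) ≤ ∣N⁺(v)∣.
module Submission where

open import Defs
open import Data.Nat using (ℕ; suc; _+_; _≤_)
open import Data.Fin.Subset using (Subset; ∣_∣; Nonempty)

open import Data.Bool using (Bool; true; false)
open import Data.Nat using (_<_)
open import Data.Nat.Properties
  using (≤-refl; ≤-trans; m⊓n≤m; m⊓n≤n; +-comm; +-suc; +-assoc; +-monoˡ-≤; +-monoʳ-≤; module ≤-Reasoning)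
open import Data.Fin using (Fin)
import Data.Fin as F
open import Data.Fin.Subset using (_∈_; _∉_; _∩_; ∁; _⊆_)
open import Data.Fin.Subset.Properties
  using (_∈?_; nonempty?; ∩-comm; x∈p∩q⁺; x∈p∩q⁻; x∉p⇒x∈∁p; x∈∁p⇒x∉p; x∉∁p⇒x∈p; p⊆q⇒∣p∣≤∣q∣; p⊂q⇒∣p∣<∣q∣)
open import Data.Vec using ([]; _∷_; tabulate)
open import Data.Vec.Properties using ([]=⇒lookup; lookup∘tabulate)
open import Data.Product using (∃; ∃₂; _×_; _,_)
open import Relation.Nullary using (¬_; yes; no)
open import Relation.Unary using (Pred; Decidable)
open import Relation.Binary.Core using (Rel)
open import Relation.Binary.PropositionalEquality using (_≡_; refl; sym; trans; cong)
open import Relation.Binary.Construct.Closure.ReflexiveTransitive using (Star; ε; _◅_)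

minFin-≤ : ∀ {n} (f : Fin (suc n) → ℕ) (v : Fin (suc n)) → minFin f ≤ f v
minFin-≤ {ℕ.zero} f F.zero = ≤-refl
minFin-≤ {suc n} f F.zero = m⊓n≤m _ _
minFin-≤ {suc n} f (F.suc v) = ≤-trans (m⊓n≤n _ _) (minFin-≤ (λ i → f (F.suc i)) v)

∣p∩q∣+∣p∩∁q∣≡∣p∣ : ∀ {n} (p q : Subset n) → ∣ p ∩ q ∣ + ∣ p ∩ ∁ q ∣ ≡ ∣ p ∣
∣p∩q∣+∣p∩∁q∣≡∣p∣ [] [] = refl
∣p∩q∣+∣p∩∁q∣≡∣p∣ (false ∷ p) (_ ∷ q) = ∣p∩q∣+∣p∩∁q∣≡∣p∣ p q
∣p∩q∣+∣p∩∁q∣≡∣p∣ (true ∷ p) (true ∷ q) = cong suc (∣p∩q∣+∣p∩∁q∣≡∣p∣ p q)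
∣p∩q∣+∣p∩∁q∣≡∣p∣ (true ∷ p) (false ∷ q) =
  trans (+-suc ∣ p ∩ q ∣ _) (cong suc (∣p∩q∣+∣p∩∁q∣≡∣p∣ p q))

∣p∩r∣+∣q∩r∣≤∣r∣ : ∀ {n} (p q r : Subset n) → (∀ {x} → x ∈ p → x ∉ q) →
                  ∣ p ∩ r ∣ + ∣ q ∩ r ∣ ≤ ∣ r ∣
∣p∩r∣+∣q∩r∣≤∣r∣ p q r p∉q = begin
  ∣ p ∩ r ∣ + ∣ q ∩ r ∣      ≡⟨ cong (λ s → ∣ s ∣ + ∣ q ∩ r ∣) (∩-comm p r) ⟩
  ∣ r ∩ p ∣ + ∣ q ∩ r ∣      ≤⟨ +-monoʳ-≤ ∣ r ∩ p ∣ (p⊆q⇒∣p∣≤∣q∣ q∩r⊆r∩∁p) ⟩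
  ∣ r ∩ p ∣ + ∣ r ∩ ∁ p ∣    ≡⟨ ∣p∩q∣+∣p∩∁q∣≡∣p∣ r p ⟩
  ∣ r ∣                      ∎
  where
  open ≤-Reasoning
  q∩r⊆r∩∁p : q ∩ r ⊆ r ∩ ∁ p
  q∩r⊆r∩∁p x∈q∩r with x∈p∩q⁻ q r x∈q∩r
  ... | x∈q , x∈r = x∈p∩q⁺ (x∈r , x∉p⇒x∈∁p (λ x∈p → p∉q x∈p x∈q))

∈-tabulate⁻ : ∀ {n} (f : Fin n → Bool) {i} → i ∈ tabulate f → f i ≡ true
∈-tabulate⁻ f {i} i∈f = trans (sym (lookup∘tabulate f i)) ([]=⇒lookup i∈f)

Star-crossing : ∀ {a p r} {A : Set a} {R : Rel A r} {P : Pred A p} → Decidable P →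
                ∀ {x y} → Star R x y → P x → ¬ P y → ∃₂ λ u w → P u × ¬ P w × R u w
Star-crossing P? ε Px ¬Py with () ← ¬Py Px
Star-crossing P? (_◅_ {j = z} xRz z⋯y) Px ¬Py with P? z
... | yes Pz = Star-crossing P? z⋯y Pz ¬Py
... | no ¬Pz = _ , z , Px , ¬Pz , xRz

module _ {n : ℕ} (G : SignedGraph n) where
  open SignedGraph G

  v∉N⁺v : ∀ v → v ∉ N⁺ G v
  v∉N⁺v v v∈N⁺v with () ← trans (sym (∈-tabulate⁻ (pos v) v∈N⁺v)) (pos-irrefl v)

  N⁺-N⁻-disjoint : ∀ {w x} → x ∈ N⁺ G w → x ∉ N⁻ G w
  N⁺-N⁻-disjoint {w} {x} x∈N⁺ x∈N⁻
    with () ← trans (sym (disjoint w x (∈-tabulate⁻ (pos w) x∈N⁺))) (∈-tabulate⁻ (neg w) x∈N⁻)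

  deg⁺S+deg⁺∁S≡∣N⁺∣ : ∀ S w → deg⁺ G S w + deg⁺ G (∁ S) w ≡ ∣ N⁺ G w ∣
  deg⁺S+deg⁺∁S≡∣N⁺∣ S w = ∣p∩q∣+∣p∩∁q∣≡∣p∣ (N⁺ G w) S

  deg⁺+deg⁻≤∣S∣ : ∀ S w → deg⁺ G S w + deg⁻ G S w ≤ ∣ S ∣
  deg⁺+deg⁻≤∣S∣ S w = ∣p∩r∣+∣q∩r∣≤∣r∣ (N⁺ G w) (N⁻ G w) S N⁺-N⁻-disjoint

  boundary-nonempty : Connected G → ∀ {S x y} → x ∈ S → y ∉ S → ∃ (InBoundary G S)
  boundary-nonempty conn {S} {x} {y} x∈S y∉S
    with u , w , u∈S , w∉S , uw ← Star-crossing (_∈? S) (conn x y) x∈S y∉S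
    = w , w∉S , u , u∈S , uw

  alliance-boundary-∣N⁺∣<∣S∣ : ∀ {S w} → IsOffensiveAlliance G S → InBoundary G S w →
                                ∣ N⁺ G w ∣ < ∣ S ∣
  alliance-boundary-∣N⁺∣<∣S∣ {S} {w} alliance w∈∂S with _ , outside+1≤inside⁻ ← alliance w w∈∂S
    = begin
    suc ∣ N⁺ G w ∣                            ≡⟨ +-comm 1 _ ⟩
    ∣ N⁺ G w ∣ + 1                            ≡⟨ cong (_+ 1) (sym (deg⁺S+deg⁺∁S≡∣N⁺∣ S w)) ⟩
    deg⁺ G S w + deg⁺ G (∁ S) w + 1           ≡⟨ +-assoc (deg⁺ G S w) _ 1 ⟩
    deg⁺ G S w + (deg⁺ G (∁ S) w + 1)         ≤⟨ +-monoʳ-≤ (deg⁺ G S w) outside+1≤inside⁻ ⟩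
    deg⁺ G S w + deg⁻ G S w                   ≤⟨ deg⁺+deg⁻≤∣S∣ S w ⟩
    ∣ S ∣                                     ∎
    where open ≤-Reasoning

  alliance-exceeds-some-∣N⁺∣ : Connected G → ∀ {S} → Nonempty S → IsOffensiveAlliance G S →
                               ∃ λ v → ∣ N⁺ G v ∣ < ∣ S ∣
  alliance-exceeds-some-∣N⁺∣ conn {S} (s , s∈S) alliance with nonempty? (∁ S)
  ... | yes (t , t∈∁S) =
    let w , w∈∂S = boundary-nonempty conn s∈S (x∈∁p⇒x∉p t∈∁S)
    in w , alliance-boundary-∣N⁺∣<∣S∣ alliance w∈∂S
  ... | no ∁S-empty =
    s , p⊂q⇒∣p∣<∣q∣ ((λ _ → x∉∁p⇒x∈p (λ x∈∁S → ∁S-empty (_ , x∈∁S))) , s , s∈S , v∉N⁺v s)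

proposition1 : ∀ (n : ℕ) (G : SignedGraph (suc n)) → Connected G →
    ∀ (S : Subset (suc n)) → Nonempty S → IsOffensiveAlliance G S →
    δ⁺ G + 1 ≤ ∣ S ∣
proposition1 n G conn S S≢∅ alliance with v , ∣N⁺v∣<∣S∣ ← alliance-exceeds-some-∣N⁺∣ G conn S≢∅ alliance
  = begin
  δ⁺ G + 1        ≤⟨ +-monoˡ-≤ 1 (minFin-≤ (λ u → ∣ N⁺ G u ∣) v) ⟩
  ∣ N⁺ G v ∣ + 1  ≡⟨ +-comm _ 1 ⟩
  suc ∣ N⁺ G v ∣  ≤⟨ ∣N⁺v∣<∣S∣ ⟩
  ∣ S ∣           ∎
  where open ≤-Reasoning
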